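{- Let $k\geq 1$. The limit $\lim_{n\to\infty} U_k(n)/k^{2n}$ exists.
   Context: $\Sigma_k=\{0,1,\ldots,k-1\}$ and $\Sigma_k^n$ is the set of length-$n$ words over $\Sigma_k$. For a pair of words $(u,v)$: a right-border is a non-empty word that is a proper suffix of $u$ and a proper prefix of $v$; a left-border is a non-empty word that is a proper prefix of $u$ and a proper suffix of $v$. The pair is mutually unbordered if it has neither a right-border nor a left-border. $U_k(n)$ is the number of mutually unbordered pairs $(u,v)\in\Sigma_k^n\times\Sigma_k^n$. -}

module Defs where

open import Data.Nat using (ℕ; zero; suc; _*_; _^_; _∸_; _≤_; NonZero)
open import Data.Nat.Properties using (m^n≢0)
open import Data.Fin using (Fin)
open import Data.Fin.Properties using () renaming (_≟_ to _≟F_)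
open import Data.List using (List; []; _∷_; map; concatMap; take; drop; length; filter; cartesianProduct; upTo; allFin)
open import Data.List.Properties using (≡-dec)
open import Data.List.Relation.Unary.Any using (Any; any?)
open import Data.Product using (_×_; _,_; proj₁; proj₂)
open import Data.Sum using (_⊎_)
open import Data.Integer using (+_)
open import Data.Rational using (ℚ; _/_; _-_; ∣_∣; _<_; 0ℚ)
open import Data.Product using (∃-syntax)
open import Relation.Binary.PropositionalEquality using (_≡_)
open import Relation.Nullary using (¬_; Dec)
open import Relation.Nullary.Decidable using (_×-dec_; _⊎-dec_; ¬?)
open import Data.Nat.Properties using (_≤?_)

words : (k n : ℕ) → List (List (Fin k))
words k zero    = [] ∷ []
words k (suc n) = concatMap (λ a → map (a ∷_) (words k n)) (allFin k)

-- For words u, v of common length n: a (right/left) border is a common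
-- word of length l with 1 ≤ l < n (non-empty and proper).
RightBorderOfLen : {k : ℕ} (n : ℕ) (u v : List (Fin k)) (l : ℕ) → Set
RightBorderOfLen n u v l = 1 ≤ l × drop (n ∸ l) u ≡ take l v

LeftBorderOfLen : {k : ℕ} (n : ℕ) (u v : List (Fin k)) (l : ℕ) → Set
LeftBorderOfLen n u v l = 1 ≤ l × take l u ≡ drop (n ∸ l) v

-- upTo n = [0, 1, ..., n-1], so l ranges over l < n.
HasBorder : {k : ℕ} (n : ℕ) (u v : List (Fin k)) → Set
HasBorder n u v = Any (λ l → RightBorderOfLen n u v l ⊎ LeftBorderOfLen n u v l) (upTo n)

MutuallyUnbordered : {k : ℕ} (n : ℕ) (u v : List (Fin k)) → Set
MutuallyUnbordered n u v = ¬ HasBorder n u v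

mutuallyUnbordered? : {k : ℕ} (n : ℕ) (p : List (Fin k) × List (Fin k)) →
                      Dec (MutuallyUnbordered n (proj₁ p) (proj₂ p))
mutuallyUnbordered? n (u , v) =
  ¬? (any? (λ l → ((1 ≤? l) ×-dec ≡-dec _≟F_ (drop (n ∸ l) u) (take l v))
               ⊎-dec ((1 ≤? l) ×-dec ≡-dec _≟F_ (take l u) (drop (n ∸ l) v)))
           (upTo n))

U : (k n : ℕ) → ℕ
U k n = length (filter (mutuallyUnbordered? n) (cartesianProduct (words k n) (words k n)))

ratio : (k : ℕ) .{{_ : NonZero k}} → ℕ → ℚ
ratio k n = _/_ (+ U k n) (k ^ (2 * n)) {{m^n≢0 k (2 * n)}}

-- Convergence of a rational sequence (to a real limit), via the Cauchy criterion.
Converges : (ℕ → ℚ) → Set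
Converges a = ∀ (ε : ℚ) → 0ℚ < ε → ∃[ N ] (∀ m n → N ≤ m → N ≤ n → ∣ a m - a n ∣ < ε)

-- Call a pair of words L-free if it has no border of length less than L (#noBorderBelow counts
-- them). A border of length l < L only involves the first and last L letters of each word, so
-- for n ≥ 2L the proportion c_L of L-free pairs among all pairs of length n does not depend on n.
-- Every mutually unbordered pair is L-free, and an L-free pair that is not mutually unbordered
-- has a border of some length l ∈ [L, n), which happens for at most 2 k^(2n-l) pairs. Summing
-- the geometric series, for k ≥ 2 and n ≥ 2L
--   U_k(n) / k^(2n)  ≤  c_L  ≤  U_k(n) / k^(2n) + 4 / k^L,
-- so the sequence is Cauchy. For k = 1 every pair of length n ≥ 2 has a border of length 1.
module Submission where

open import Defs
open import Level using (Level)
open import Data.Bool.Base using (true; false)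
open import Data.Fin.Base using (Fin)
open import Data.Fin.Properties using (_≟_)
open import Data.Integer.Base as ℤ using (+_; +0; +[1+_]; -[1+_]; +≤+; +<+)
import Data.Integer.Properties as ℤₚ
open import Data.List.Base
  using (List; []; _∷_; _++_; map; concatMap; take; drop; length; filter; allFin; upTo;
         cartesianProductWith; cartesianProduct)
open import Data.List.Properties using (≡-dec; ∷-injective; length-tabulate; take-all)
open import Data.List.Relation.Unary.All as All using (All; []; _∷_)
import Data.List.Relation.Unary.All.Properties as All
open import Data.List.Relation.Unary.AllPairs using ([]; _∷_)
open import Data.List.Relation.Unary.Any using (Any; here; there; any?)
open import Data.List.Relation.Unary.Any.Properties using (applyUpTo⁺; applyUpTo⁻)
open import Data.List.Relation.Unary.Unique.Propositional using (Unique)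
import Data.List.Relation.Unary.Unique.Propositional.Properties as Unique
open import Data.Nat.Base using (ℕ; zero; suc; _+_; _*_; _∸_; _^_; _≤_; _<_; z≤n; s≤s; z<s; NonZero)
open import Data.Nat.Properties hiding (_≟_)
open import Data.Nat.Tactic.RingSolver using (solve-∀)
open import Data.Product.Base using (_×_; _,_; proj₂; ∃-syntax)
open import Data.Rational.Base as ℚ using (ℚ; mkℚ; 0ℚ; _/_; -_; ∣_∣; toℚᵘ)
import Data.Rational.Properties as ℚₚ
open import Data.Rational.Unnormalised.Base as ℚᵘ using (mkℚᵘ)
import Data.Rational.Unnormalised.Properties as ℚᵘₚ
open import Data.Sum.Base using (_⊎_; inj₁; inj₂)
open import Function.Base using (id; _∘_)
open import Relation.Binary.Definitions using (DecidableEquality)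
open import Relation.Binary.PropositionalEquality
open import Relation.Nullary using (Dec; yes; no; _because_; contradiction)
open import Relation.Nullary.Decidable using (¬?; _×-dec_; _⊎-dec_)
open import Algebra.Properties.AbelianGroup ℚₚ.+-0-abelianGroup using (xyx⁻¹≈y; ⁻¹-anti-homo‿-)

private
  variable
    a b c ℓ ℓ′ : Level
    A : Set a
    B : Set b
    C : Set c
    P : Set ℓ
    Q : Set ℓ′

𝟙 : Dec P → ℕ
𝟙 (true  because _) = 1
𝟙 (false because _) = 0

𝟙-mono : (P? : Dec P) (Q? : Dec Q) → (P → Q) → 𝟙 P? ≤ 𝟙 Q?
𝟙-mono (yes _) (yes _) _   = ≤-refl
𝟙-mono (yes p) (no ¬q) p⇒q = contradiction (p⇒q p) ¬q
𝟙-mono (no _)  _       _   = z≤n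

𝟙-cong : (P? : Dec P) (Q? : Dec Q) → (P → Q) → (Q → P) → 𝟙 P? ≡ 𝟙 Q?
𝟙-cong P? Q? p⇒q q⇒p = ≤-antisym (𝟙-mono P? Q? p⇒q) (𝟙-mono Q? P? q⇒p)

1≤𝟙 : (P? : Dec P) → P → 1 ≤ 𝟙 P?
1≤𝟙 P? p = 𝟙-mono (yes p) P? id

𝟙-⊎ : (P? : Dec P) (Q? : Dec Q) → 𝟙 (P? ⊎-dec Q?) ≤ 𝟙 P? + 𝟙 Q?
𝟙-⊎ (yes _) Q?      = m≤m+n 1 (𝟙 Q?)
𝟙-⊎ (no _)  (yes _) = ≤-refl
𝟙-⊎ (no _)  (no _)  = z≤n

∑ : List A → (A → ℕ) → ℕ
∑ []       f = 0
∑ (x ∷ xs) f = f x + ∑ xs f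

syntax ∑ xs (λ x → e) = ∑[ x ∈ xs ] e

module _ {f g : A → ℕ} where

  ∑-cong : ∀ xs → (∀ x → f x ≡ g x) → ∑ xs f ≡ ∑ xs g
  ∑-cong []       f≡g = refl
  ∑-cong (x ∷ xs) f≡g = cong₂ _+_ (f≡g x) (∑-cong xs f≡g)

  ∑-mono : ∀ xs → (∀ x → f x ≤ g x) → ∑ xs f ≤ ∑ xs g
  ∑-mono []       f≤g = z≤n
  ∑-mono (x ∷ xs) f≤g = +-mono-≤ (f≤g x) (∑-mono xs f≤g)

  ∑-cong-All : ∀ {R : A → Set ℓ} {xs} → All R xs → (∀ {x} → R x → f x ≡ g x) → ∑ xs f ≡ ∑ xs g
  ∑-cong-All []         f≡g = refl
  ∑-cong-All (rx ∷ rxs) f≡g = cong₂ _+_ (f≡g rx) (∑-cong-All rxs f≡g)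

  ∑-mono-All : ∀ {R : A → Set ℓ} {xs} → All R xs → (∀ {x} → R x → f x ≤ g x) → ∑ xs f ≤ ∑ xs g
  ∑-mono-All []         f≤g = z≤n
  ∑-mono-All (rx ∷ rxs) f≤g = +-mono-≤ (f≤g rx) (∑-mono-All rxs f≤g)

  ∑-+ : ∀ xs → ∑[ x ∈ xs ] (f x + g x) ≡ ∑ xs f + ∑ xs g
  ∑-+ []       = refl
  ∑-+ (x ∷ xs) = trans (cong (_+_ (f x + g x)) (∑-+ xs)) (+-+-comm (f x) (g x) _ _)
    where
    +-+-comm : ∀ m n o r → m + n + (o + r) ≡ m + o + (n + r)
    +-+-comm = solve-∀

∑-*ˡ : ∀ m xs (f : A → ℕ) → ∑[ x ∈ xs ] (m * f x) ≡ m * ∑ xs f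
∑-*ˡ m []       f = sym (*-zeroʳ m)
∑-*ˡ m (x ∷ xs) f = trans (cong (_+_ (m * f x)) (∑-*ˡ m xs f)) (sym (*-distribˡ-+ m (f x) _))

∑-const : ∀ (xs : List A) m → ∑[ x ∈ xs ] m ≡ length xs * m
∑-const []       m = refl
∑-const (x ∷ xs) m = cong (_+_ m) (∑-const xs m)

∑-++ : ∀ xs ys (f : A → ℕ) → ∑ (xs ++ ys) f ≡ ∑ xs f + ∑ ys f
∑-++ []       ys f = refl
∑-++ (x ∷ xs) ys f = trans (cong (_+_ (f x)) (∑-++ xs ys f)) (sym (+-assoc (f x) _ _))

∑-map : ∀ (h : A → B) xs (f : B → ℕ) → ∑ (map h xs) f ≡ ∑ xs (f ∘ h)
∑-map h []       f = refl
∑-map h (x ∷ xs) f = cong (_+_ (f (h x))) (∑-map h xs f)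

∑-cartesianProductWith : ∀ (h : A → B → C) xs ys (f : C → ℕ) →
                         ∑ (cartesianProductWith h xs ys) f ≡ ∑[ x ∈ xs ] ∑[ y ∈ ys ] f (h x y)
∑-cartesianProductWith h []       ys f = refl
∑-cartesianProductWith h (x ∷ xs) ys f = begin
  ∑ (map (h x) ys ++ cartesianProductWith h xs ys) f         ≡⟨ ∑-++ (map (h x) ys) _ f ⟩
  ∑ (map (h x) ys) f + ∑ (cartesianProductWith h xs ys) f   ≡⟨ cong₂ _+_ (∑-map (h x) ys f)
                                                                     (∑-cartesianProductWith h xs ys f) ⟩
  ∑[ y ∈ ys ] f (h x y) + ∑[ x ∈ xs ] ∑[ y ∈ ys ] f (h x y)  ∎
  where open ≡-Reasoning

∑-comm : ∀ (xs : List A) (ys : List B) (f : A → B → ℕ) →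
         ∑[ x ∈ xs ] ∑[ y ∈ ys ] f x y ≡ ∑[ y ∈ ys ] ∑[ x ∈ xs ] f x y
∑-comm []       ys f = sym (trans (∑-const ys 0) (*-zeroʳ (length ys)))
∑-comm (x ∷ xs) ys f = trans (cong (_+_ (∑ ys (f x))) (∑-comm xs ys f)) (sym (∑-+ ys))

length-filter : ∀ {R : A → Set ℓ} (R? : ∀ x → Dec (R x)) xs →
                length (filter R? xs) ≡ ∑[ x ∈ xs ] 𝟙 (R? x)
length-filter R? []       = refl
length-filter R? (x ∷ xs) with R? x
... | yes _ = cong suc (length-filter R? xs)
... | no  _ = length-filter R? xs

Any⇒≤∑ : ∀ {m} {f : A → ℕ} {xs} → Any (λ x → m ≤ f x) xs → m ≤ ∑ xs f
Any⇒≤∑                 (here m≤fx) = ≤-trans m≤fx (m≤m+n _ _)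
Any⇒≤∑ {f = f} {x ∷ _} (there m≤∑) = ≤-trans (Any⇒≤∑ m≤∑) (m≤n+m _ (f x))

module _ (_≟ᴬ_ : DecidableEquality A) where

  ∑-𝟙≟-≤1 : ∀ {xs} → Unique xs → ∀ y → ∑[ x ∈ xs ] 𝟙 (y ≟ᴬ x) ≤ 1
  ∑-𝟙≟-≤1 []                    y = z≤n
  ∑-𝟙≟-≤1 {x ∷ xs} (x∉xs ∷ xs!) y with y ≟ᴬ x
  ... | yes refl = ≤-reflexive (cong suc (none x∉xs))
    where
    none : ∀ {zs} → All (y ≢_) zs → ∑[ z ∈ zs ] 𝟙 (y ≟ᴬ z) ≡ 0
    none []                 = refl
    none {z ∷ _} (y≢z ∷ ps) with y ≟ᴬ z
    ... | yes y≡z = contradiction y≡z y≢z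
    ... | no  _   = none ps
  ... | no  _    = ∑-𝟙≟-≤1 xs! y

Word : ℕ → Set
Word k = List (Fin k)

_≟ʷ_ : ∀ {k} → DecidableEquality (Word k)
_≟ʷ_ = ≡-dec _≟_

module _ (k : ℕ) where

  words-suc : ∀ n → words k (suc n) ≡ cartesianProductWith _∷_ (allFin k) (words k n)
  words-suc n = go (allFin k)
    where
    go : ∀ as → concatMap (λ a → map (a ∷_) (words k n)) as ≡ cartesianProductWith _∷_ as (words k n)
    go []       = refl
    go (a ∷ as) = cong (map (a ∷_) (words k n) ++_) (go as)

  words-length : ∀ n → All (λ w → length w ≡ n) (words k n)
  words-length zero    = refl ∷ []
  words-length (suc n) = subst (All _) (sym (words-suc n))
    (All.cartesianProductWith⁺ (setoid (Fin k)) (setoid (Word k)) _∷_ (allFin k) (words k n)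
      (λ _ w∈ → cong suc (All.lookup (words-length n) w∈)))

  words-unique : ∀ n → Unique (words k n)
  words-unique zero    = [] ∷ []
  words-unique (suc n) = subst Unique (sym (words-suc n))
    (Unique.cartesianProductWith⁺ _∷_ ∷-injective (Unique.allFin⁺ k) (words-unique n))

  ∑-words-suc : ∀ n (f : Word k → ℕ) →
                ∑ (words k (suc n)) f ≡ ∑[ a ∈ allFin k ] ∑[ w ∈ words k n ] f (a ∷ w)
  ∑-words-suc n f =
    trans (cong (λ ws → ∑ ws f) (words-suc n)) (∑-cartesianProductWith _∷_ (allFin k) (words k n) f)

  ∑-words-++ : ∀ m n (f : Word k → ℕ) →
               ∑ (words k (m + n)) f ≡ ∑[ x ∈ words k m ] ∑[ y ∈ words k n ] f (x ++ y)
  ∑-words-++ zero    n f = sym (+-identityʳ _)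
  ∑-words-++ (suc m) n f = begin
    ∑ (words k (suc (m + n))) f                                 ≡⟨ ∑-words-suc (m + n) f ⟩
    ∑[ a ∈ allFin k ] ∑[ w ∈ words k (m + n) ] f (a ∷ w)        ≡⟨ ∑-cong (allFin k) (λ a →
                                                                     ∑-words-++ m n (f ∘ (a ∷_))) ⟩
    ∑[ a ∈ allFin k ] ∑[ x ∈ words k m ] ∑[ y ∈ words k n ]
      f (a ∷ x ++ y)                                            ≡⟨ ∑-words-suc m _ ⟨
    ∑[ x ∈ words k (suc m) ] ∑[ y ∈ words k n ] f (x ++ y)      ∎
    where open ≡-Reasoning

  ∑-words-const : ∀ n m → ∑[ w ∈ words k n ] m ≡ k ^ n * m
  ∑-words-const zero    m = refl
  ∑-words-const (suc n) m = begin
    ∑[ w ∈ words k (suc n) ] m              ≡⟨ ∑-words-suc n _ ⟩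
    ∑[ a ∈ allFin k ] ∑[ w ∈ words k n ] m  ≡⟨ ∑-cong (allFin k) (λ _ → ∑-words-const n m) ⟩
    ∑[ a ∈ allFin k ] (k ^ n * m)           ≡⟨ ∑-const (allFin k) _ ⟩
    length (allFin k) * (k ^ n * m)         ≡⟨ cong (_* (k ^ n * m)) (length-tabulate {n = k} id) ⟩
    k * (k ^ n * m)                         ≡⟨ *-assoc k (k ^ n) m ⟨
    k ^ suc n * m                           ∎
    where open ≡-Reasoning

  ∑-words-cong : ∀ n {f g : Word k → ℕ} → (∀ {w} → length w ≡ n → f w ≡ g w) →
                 ∑ (words k n) f ≡ ∑ (words k n) g
  ∑-words-cong n = ∑-cong-All (words-length n)

  ∑-words-mono : ∀ n {f g : Word k → ℕ} → (∀ {w} → length w ≡ n → f w ≤ g w) →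
                 ∑ (words k n) f ≤ ∑ (words k n) g
  ∑-words-mono n = ∑-mono-All (words-length n)

  ∑-words-≤ : ∀ n {m} {f : Word k → ℕ} → (∀ {w} → length w ≡ n → f w ≤ m) →
              ∑ (words k n) f ≤ k ^ n * m
  ∑-words-≤ n {m} f≤m = ≤-trans (∑-words-mono n f≤m) (≤-reflexive (∑-words-const n m))

  ∑-words-𝟙≟-≤1 : ∀ n (w : Word k) → ∑[ x ∈ words k n ] 𝟙 (w ≟ʷ x) ≤ 1
  ∑-words-𝟙≟-≤1 n = ∑-𝟙≟-≤1 _≟ʷ_ (words-unique n)

∑-words-middle : ∀ k p t q (f g : Word k → ℕ) →
                 (∀ x m y → length x ≡ p → length m ≡ t → length y ≡ q →
                    f (x ++ (m ++ y)) ≡ g (x ++ y)) →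
                 ∑ (words k (p + (t + q))) f ≡ k ^ t * ∑ (words k (p + q)) g
∑-words-middle k p t q f g f≡g = begin
  ∑ (words k (p + (t + q))) f                                   ≡⟨ ∑-words-++ k p (t + q) f ⟩
  ∑[ x ∈ words k p ] ∑[ w ∈ words k (t + q) ] f (x ++ w)        ≡⟨ ∑-cong (words k p) (λ x →
                                                                     ∑-words-++ k t q _) ⟩
  ∑[ x ∈ words k p ] ∑[ m ∈ words k t ] ∑[ y ∈ words k q ]
    f (x ++ (m ++ y))                                           ≡⟨ ∑-words-cong k p (λ {x} hx →
                                                                     ∑-words-cong k t (λ {m} hm →
                                                                     ∑-words-cong k q (λ {y} hy →
                                                                     f≡g x m y hx hm hy))) ⟩
  ∑[ x ∈ words k p ] ∑[ m ∈ words k t ] ∑[ y ∈ words k q ]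
    g (x ++ y)                                                  ≡⟨ ∑-cong (words k p) (λ x →
                                                                     ∑-words-const k t _) ⟩
  ∑[ x ∈ words k p ] (k ^ t * ∑[ y ∈ words k q ] g (x ++ y))    ≡⟨ ∑-*ˡ (k ^ t) (words k p) _ ⟩
  k ^ t * ∑[ x ∈ words k p ] ∑[ y ∈ words k q ] g (x ++ y)      ≡⟨ cong (k ^ t *_) (∑-words-++ k p q g) ⟨
  k ^ t * ∑ (words k (p + q)) g                                 ∎
  where open ≡-Reasoning

take-++ : ∀ {l} (xs ys : List A) → l ≤ length xs → take l (xs ++ ys) ≡ take l xs
take-++ {l = zero}  xs       ys _         = refl
take-++ {l = suc l} (x ∷ xs) ys (s≤s l≤n) = cong (x ∷_) (take-++ xs ys l≤n)

drop-++ : ∀ (xs ys : List A) m → drop (length xs + m) (xs ++ ys) ≡ drop m ys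
drop-++ []       ys m = refl
drop-++ (x ∷ xs) ys m = drop-++ xs ys m

take-++-length : ∀ {l} (xs ys : List A) → length xs ≡ l → take l (xs ++ ys) ≡ xs
take-++-length xs ys refl = trans (take-++ xs ys ≤-refl) (take-all _ xs ≤-refl)

drop-++-length : ∀ {l} (xs ys : List A) → length xs ≡ l → drop l (xs ++ ys) ≡ ys
drop-++-length xs ys refl =
  trans (cong (λ i → drop i (xs ++ ys)) (sym (+-identityʳ (length xs)))) (drop-++ xs ys 0)

drop-∸-++ : ∀ {m n l} (xs ys : List A) → length xs ≡ m → l ≤ n →
            drop (m + n ∸ l) (xs ++ ys) ≡ drop (n ∸ l) ys
drop-∸-++ {n = n} {l} xs ys refl l≤n =
  trans (cong (λ i → drop i (xs ++ ys)) (+-∸-assoc (length xs) l≤n)) (drop-++ xs ys (n ∸ l))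

Any-upTo-map : ∀ {R S : ℕ → Set ℓ} {L M} → L ≤ M → (∀ {l} → l < L → R l → S l) →
               Any R (upTo L) → Any S (upTo M)
Any-upTo-map L≤M R⇒S R-any with applyUpTo⁻ id R-any
... | l , l<L , Rl = applyUpTo⁺ id (R⇒S l<L Rl) (≤-trans l<L L≤M)

[_,+_⟩ : ℕ → ℕ → List ℕ
[ L ,+ zero  ⟩ = []
[ L ,+ suc j ⟩ = L ∷ [ suc L ,+ j ⟩

[,+⟩-Any : ∀ {R : ℕ → Set ℓ} L j {l} → L ≤ l → l < L + j → R l → Any R [ L ,+ j ⟩
[,+⟩-Any L zero        L≤l l<L+0 _  =
  contradiction (≤-trans l<L+0 (≤-reflexive (+-identityʳ L))) (≤⇒≯ L≤l)
[,+⟩-Any L (suc j) {l} L≤l l<L+j Rl with m≤n⇒m<n∨m≡n L≤l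
... | inj₂ refl = here Rl
... | inj₁ L<l  = there ([,+⟩-Any (suc L) j L<l (≤-trans l<L+j (≤-reflexive (+-suc L j))) Rl)

[,+⟩-All< : ∀ L j → All (_< L + j) [ L ,+ j ⟩
[,+⟩-All< L zero    = []
[,+⟩-All< L (suc j) =
  m<m+n L z<s ∷ All.map (λ l< → ≤-trans l< (≤-reflexive (sym (+-suc L j)))) ([,+⟩-All< (suc L) j)

-- The slack + 2 is what makes the induction step close.
∑-[,+⟩-geometric : ∀ {k} → 2 ≤ k → ∀ L j {n} → n ≡ L + j →
                   ∑[ l ∈ [ L ,+ j ⟩ ] (k ^ (n ∸ l)) + 2 ≤ 2 * k ^ j
∑-[,+⟩-geometric         2≤k L zero    _     = ≤-refl
∑-[,+⟩-geometric {k} 2≤k L (suc j) {n} n≡L+j = begin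
  k ^ (n ∸ L) + ∑[ l ∈ [ suc L ,+ j ⟩ ] (k ^ (n ∸ l)) + 2    ≡⟨ +-assoc (k ^ (n ∸ L)) _ 2 ⟩
  k ^ (n ∸ L) + (∑[ l ∈ [ suc L ,+ j ⟩ ] (k ^ (n ∸ l)) + 2)  ≤⟨ +-mono-≤ (≤-reflexive (cong (k ^_) n∸L≡1+j))
                                                                  (∑-[,+⟩-geometric 2≤k (suc L) j n≡1+L+j) ⟩
  k ^ suc j + 2 * k ^ j                                      ≤⟨ +-monoʳ-≤ (k ^ suc j)
                                                                  (*-monoˡ-≤ (k ^ j) 2≤k) ⟩
  k ^ suc j + k ^ suc j                                      ≡⟨ cong (_+_ (k ^ suc j)) (+-identityʳ _) ⟨
  2 * k ^ suc j                                              ∎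
  where
  open ≤-Reasoning
  n∸L≡1+j : n ∸ L ≡ suc j
  n∸L≡1+j = trans (cong (_∸ L) n≡L+j) (m+n∸m≡n L (suc j))
  n≡1+L+j : n ≡ suc L + j
  n≡1+L+j = trans n≡L+j (+-suc L j)

Border : ∀ {k} (n : ℕ) (u v : Word k) (l : ℕ) → Set
Border n u v l = RightBorderOfLen n u v l ⊎ LeftBorderOfLen n u v l

-- The decision procedure inside mutuallyUnbordered?, so that U≡#noBorderBelow holds by computation.
border? : ∀ {k} n (u v : Word k) l → Dec (Border n u v l)
border? n u v l =
  ((1 ≤? l) ×-dec (drop (n ∸ l) u ≟ʷ take l v)) ⊎-dec ((1 ≤? l) ×-dec (take l u ≟ʷ drop (n ∸ l) v))

BorderBelow : ∀ {k} (L n : ℕ) (u v : Word k) → Set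
BorderBelow L n u v = Any (Border n u v) (upTo L)

borderBelow? : ∀ {k} L n (u v : Word k) → Dec (BorderBelow L n u v)
borderBelow? L n u v = any? (border? n u v) (upTo L)

Border-cong : ∀ {k n n′ l} {u v u′ v′ : Word k} →
              take l u ≡ take l u′ → drop (n ∸ l) u ≡ drop (n′ ∸ l) u′ →
              take l v ≡ take l v′ → drop (n ∸ l) v ≡ drop (n′ ∸ l) v′ →
              Border n u v l → Border n′ u′ v′ l
Border-cong tu du tv dv (inj₁ (1≤l , e)) = inj₁ (1≤l , trans (sym du) (trans e tv))
Border-cong tu du tv dv (inj₂ (1≤l , e)) = inj₂ (1≤l , trans (sym tu) (trans e dv))

#noBorderBelow : (k L n : ℕ) → ℕ
#noBorderBelow k L n = ∑[ u ∈ words k n ] ∑[ v ∈ words k n ] 𝟙 (¬? (borderBelow? L n u v))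

#border : (k n l : ℕ) → ℕ
#border k n l = ∑[ u ∈ words k n ] ∑[ v ∈ words k n ] 𝟙 (border? n u v l)

U≡#noBorderBelow : ∀ k n → U k n ≡ #noBorderBelow k n n
U≡#noBorderBelow k n =
  trans (length-filter (mutuallyUnbordered? n) (cartesianProduct (words k n) (words k n)))
        (∑-cartesianProductWith _,_ (words k n) (words k n) (𝟙 ∘ mutuallyUnbordered? n))

#noBorderBelow-antitone : ∀ k n {L M} → L ≤ M → #noBorderBelow k M n ≤ #noBorderBelow k L n
#noBorderBelow-antitone k n L≤M = ∑-mono (words k n) λ u → ∑-mono (words k n) λ v →
  𝟙-mono (¬? (borderBelow? _ n u v)) (¬? (borderBelow? _ n u v))
         (λ ¬BM BL → ¬BM (Any-upTo-map L≤M (λ _ B → B) BL))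

module _ {k L t : ℕ} where

  private
    framed-ends : ∀ (x m y : Word k) → length x ≡ L → length m ≡ t → length y ≡ L → ∀ {l} → l ≤ L →
           take l (x ++ (m ++ y)) ≡ take l (x ++ y)
           × drop (L + (t + L) ∸ l) (x ++ (m ++ y)) ≡ drop (L + L ∸ l) (x ++ y)
    framed-ends x m y hx hm hy {l} l≤L = trans (take-++ x _ l≤∣x∣) (sym (take-++ x y l≤∣x∣)) , (begin
      drop (L + (t + L) ∸ l) (x ++ (m ++ y))  ≡⟨ drop-∸-++ x _ hx (≤-trans l≤L (m≤n+m L t)) ⟩
      drop (t + L ∸ l) (m ++ y)               ≡⟨ drop-∸-++ m y hm l≤L ⟩
      drop (L ∸ l) y                          ≡⟨ drop-∸-++ x y hx l≤L ⟨
      drop (L + L ∸ l) (x ++ y)               ∎)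
      where
      open ≡-Reasoning
      l≤∣x∣ : l ≤ length x
      l≤∣x∣ = ≤-trans l≤L (≤-reflexive (sym hx))

  𝟙-noBorderBelow-framed : ∀ a m b c m′ d →
                           length a ≡ L → length m ≡ t → length b ≡ L →
                           length c ≡ L → length m′ ≡ t → length d ≡ L →
                           𝟙 (¬? (borderBelow? L (L + (t + L)) (a ++ (m ++ b)) (c ++ (m′ ++ d))))
                           ≡ 𝟙 (¬? (borderBelow? L (L + L) (a ++ b) (c ++ d)))
  𝟙-noBorderBelow-framed a m b c m′ d ha hm hb hc hm′ hd =
    𝟙-cong (¬? (borderBelow? L (L + (t + L)) u v)) (¬? (borderBelow? L (L + L) u′ v′))
      (λ ¬B B → ¬B (Any-upTo-map ≤-refl from B))
      (λ ¬B B → ¬B (Any-upTo-map ≤-refl to B))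
    where
    u v u′ v′ : Word k
    u = a ++ (m ++ b)
    v = c ++ (m′ ++ d)
    u′ = a ++ b
    v′ = c ++ d
    to : ∀ {l} → l < L → Border (L + (t + L)) u v l → Border (L + L) u′ v′ l
    to l<L with framed-ends a m b ha hm hb (<⇒≤ l<L) | framed-ends c m′ d hc hm′ hd (<⇒≤ l<L)
    ... | tu , du | tv , dv = Border-cong tu du tv dv
    from : ∀ {l} → l < L → Border (L + L) u′ v′ l → Border (L + (t + L)) u v l
    from l<L with framed-ends a m b ha hm hb (<⇒≤ l<L) | framed-ends c m′ d hc hm′ hd (<⇒≤ l<L)
    ... | tu , du | tv , dv = Border-cong (sym tu) (sym du) (sym tv) (sym dv)

#noBorderBelow-framed : ∀ k L t →
                        #noBorderBelow k L (L + (t + L)) ≡ k ^ t * (k ^ t * #noBorderBelow k L (L + L))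
#noBorderBelow-framed k L t =
  trans (∑-words-middle k L t L _ _ λ a m b ha hm hb →
         ∑-words-middle k L t L _ _ λ c m′ d hc hm′ hd →
         𝟙-noBorderBelow-framed a m b c m′ d ha hm hb hc hm′ hd)
        (cong (k ^ t *_) (∑-*ˡ (k ^ t) (words k (L + L)) _))

∑-prefix-𝟙≟ : ∀ k l q (w : Word k) → ∑[ v ∈ words k (l + q) ] 𝟙 (w ≟ʷ take l v) ≤ k ^ q
∑-prefix-𝟙≟ k l q w = begin
  ∑[ v ∈ words k (l + q) ] 𝟙 (w ≟ʷ take l v)                      ≡⟨ ∑-words-++ k l q _ ⟩
  ∑[ x ∈ words k l ] ∑[ y ∈ words k q ] 𝟙 (w ≟ʷ take l (x ++ y))  ≡⟨ ∑-words-cong k l (λ {x} hx →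
                                                                       ∑-cong (words k q) (λ y →
                                                                       cong (λ z → 𝟙 (w ≟ʷ z))
                                                                            (take-++-length x y hx))) ⟩
  ∑[ x ∈ words k l ] ∑[ y ∈ words k q ] 𝟙 (w ≟ʷ x)                ≡⟨ ∑-comm (words k l) (words k q) _ ⟩
  ∑[ y ∈ words k q ] ∑[ x ∈ words k l ] 𝟙 (w ≟ʷ x)                ≤⟨ ∑-words-≤ k q (λ _ → ∑-words-𝟙≟-≤1 k l w) ⟩
  k ^ q * 1                                                       ≡⟨ *-identityʳ (k ^ q) ⟩
  k ^ q                                                           ∎
  where open ≤-Reasoning

∑-suffix-𝟙≟ : ∀ k q l (w : Word k) → ∑[ v ∈ words k (q + l) ] 𝟙 (w ≟ʷ drop q v) ≤ k ^ q
∑-suffix-𝟙≟ k q l w = begin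
  ∑[ v ∈ words k (q + l) ] 𝟙 (w ≟ʷ drop q v)                      ≡⟨ ∑-words-++ k q l _ ⟩
  ∑[ y ∈ words k q ] ∑[ x ∈ words k l ] 𝟙 (w ≟ʷ drop q (y ++ x))  ≡⟨ ∑-words-cong k q (λ {y} hy →
                                                                       ∑-cong (words k l) (λ x →
                                                                       cong (λ z → 𝟙 (w ≟ʷ z))
                                                                            (drop-++-length y x hy))) ⟩
  ∑[ y ∈ words k q ] ∑[ x ∈ words k l ] 𝟙 (w ≟ʷ x)                ≤⟨ ∑-words-≤ k q (λ _ → ∑-words-𝟙≟-≤1 k l w) ⟩
  k ^ q * 1                                                       ≡⟨ *-identityʳ (k ^ q) ⟩
  k ^ q                                                           ∎
  where open ≤-Reasoning

#border-≤ : ∀ k {n l} → l ≤ n → #border k n l ≤ k ^ n * (2 * k ^ (n ∸ l))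
#border-≤ k {n} {l} l≤n = ∑-words-≤ k n λ {u} _ → begin
  ∑[ v ∈ words k n ] 𝟙 (border? n u v l)                    ≤⟨ ∑-mono (words k n) 𝟙-border ⟩
  ∑[ v ∈ words k n ] (𝟙 (right? u v) + 𝟙 (left? u v))       ≡⟨ ∑-+ (words k n) ⟩
  ∑[ v ∈ words k n ] 𝟙 (right? u v)
    + ∑[ v ∈ words k n ] 𝟙 (left? u v)                      ≤⟨ +-mono-≤ (prefix (drop (n ∸ l) u))
                                                                         (suffix (take l u)) ⟩
  k ^ (n ∸ l) + k ^ (n ∸ l)                                 ≡⟨ cong (_+_ (k ^ (n ∸ l))) (+-identityʳ _) ⟨
  2 * k ^ (n ∸ l)                                           ∎
  where
  open ≤-Reasoning
  right? : ∀ (u v : Word k) → Dec (drop (n ∸ l) u ≡ take l v)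
  right? u v = drop (n ∸ l) u ≟ʷ take l v
  left? : ∀ (u v : Word k) → Dec (take l u ≡ drop (n ∸ l) v)
  left? u v = take l u ≟ʷ drop (n ∸ l) v
  𝟙-border : ∀ {u} v → 𝟙 (border? n u v l) ≤ 𝟙 (right? u v) + 𝟙 (left? u v)
  𝟙-border {u} v = ≤-trans (𝟙-⊎ ((1 ≤? l) ×-dec right? u v) ((1 ≤? l) ×-dec left? u v))
    (+-mono-≤ (𝟙-mono ((1 ≤? l) ×-dec right? u v) (right? u v) proj₂)
              (𝟙-mono ((1 ≤? l) ×-dec left? u v) (left? u v) proj₂))
  prefix : ∀ w → ∑[ v ∈ words k n ] 𝟙 (w ≟ʷ take l v) ≤ k ^ (n ∸ l)
  prefix w = subst (λ i → ∑[ v ∈ words k i ] 𝟙 (w ≟ʷ take l v) ≤ k ^ (n ∸ l))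
                   (m+[n∸m]≡n l≤n) (∑-prefix-𝟙≟ k l (n ∸ l) w)
  suffix : ∀ w → ∑[ v ∈ words k n ] 𝟙 (w ≟ʷ drop (n ∸ l) v) ≤ k ^ (n ∸ l)
  suffix w = subst (λ i → ∑[ v ∈ words k i ] 𝟙 (w ≟ʷ drop (n ∸ l) v) ≤ k ^ (n ∸ l))
                   (m∸n+n≡m l≤n) (∑-suffix-𝟙≟ k (n ∸ l) l w)

𝟙-noBorderBelow-≤ : ∀ {k} L j {n} → n ≡ L + j → (u v : Word k) →
                    𝟙 (¬? (borderBelow? L n u v))
                    ≤ 𝟙 (¬? (borderBelow? n n u v)) + ∑[ l ∈ [ L ,+ j ⟩ ] 𝟙 (border? n u v l)
𝟙-noBorderBelow-≤ L j {n} n≡L+j u v with borderBelow? L n u v | borderBelow? n n u v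
... | yes _     | _     = z≤n
... | no _      | no _  = s≤s z≤n
... | no ¬short | yes B with applyUpTo⁻ id B
...   | l , l<n , Bl with l <? L
...     | yes l<L = contradiction (applyUpTo⁺ id Bl l<L) ¬short
...     | no l≮L  = ≤-trans (Any⇒≤∑ ([,+⟩-Any L j (≮⇒≥ l≮L) (≤-trans l<n (≤-reflexive n≡L+j))
                                                 (1≤𝟙 (border? n u v l) Bl)))
                            (m≤n+m _ 0)

#noBorderBelow≤U+∑#border : ∀ k L j {n} → n ≡ L + j →
                            #noBorderBelow k L n ≤ U k n + ∑[ l ∈ [ L ,+ j ⟩ ] #border k n l
#noBorderBelow≤U+∑#border k L j {n} n≡L+j = begin
  #noBorderBelow k L n
    ≤⟨ ∑-mono W (λ u → ∑-mono W (λ v → 𝟙-noBorderBelow-≤ L j n≡L+j u v)) ⟩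
  ∑[ u ∈ W ] ∑[ v ∈ W ] (𝟙 (¬? (borderBelow? n n u v)) + ∑[ l ∈ I ] 𝟙 (border? n u v l))
    ≡⟨ trans (∑-cong W (λ u → ∑-+ W)) (∑-+ W) ⟩
  #noBorderBelow k n n + ∑[ u ∈ W ] ∑[ v ∈ W ] ∑[ l ∈ I ] 𝟙 (border? n u v l)
    ≡⟨ cong₂ _+_ (sym (U≡#noBorderBelow k n)) (trans (∑-cong W (λ u → ∑-comm W I _)) (∑-comm W I _)) ⟩
  U k n + ∑[ l ∈ I ] #border k n l
    ∎
  where
  open ≤-Reasoning
  W : List (Word k)
  W = words k n
  I : List ℕ
  I = [ L ,+ j ⟩

#noBorderBelow≤U+4kⁿkʲ : ∀ {k} → 2 ≤ k → ∀ L j {n} → n ≡ L + j →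
                         #noBorderBelow k L n ≤ U k n + k ^ n * (2 * (2 * k ^ j))
#noBorderBelow≤U+4kⁿkʲ {k} 2≤k L j {n} n≡L+j =
  ≤-trans (#noBorderBelow≤U+∑#border k L j n≡L+j) (+-monoʳ-≤ (U k n) (begin
    ∑[ l ∈ I ] #border k n l                ≤⟨ ∑-mono-All ([,+⟩-All< L j) (λ l< →
                                                 #border-≤ k (<⇒≤ (≤-trans l< (≤-reflexive (sym n≡L+j))))) ⟩
    ∑[ l ∈ I ] (k ^ n * (2 * k ^ (n ∸ l)))  ≡⟨ trans (∑-*ˡ (k ^ n) I _) (cong (k ^ n *_) (∑-*ˡ 2 I _)) ⟩
    k ^ n * (2 * ∑[ l ∈ I ] (k ^ (n ∸ l)))  ≤⟨ *-monoʳ-≤ (k ^ n) (*-monoʳ-≤ 2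
                                                 (≤-trans (m≤m+n _ 2) (∑-[,+⟩-geometric 2≤k L j n≡L+j))) ⟩
    k ^ n * (2 * (2 * k ^ j))               ∎))
  where
  open ≤-Reasoning
  I : List ℕ
  I = [ L ,+ j ⟩

toℚᵘ-/ : ∀ a d .{{_ : NonZero d}} → toℚᵘ (+ a / d) ℚᵘ.≃ + a ℚᵘ./ d
toℚᵘ-/ a (suc d) = ℚₚ.toℚᵘ-fromℚᵘ (mkℚᵘ (+ a) d)

cross-≤⇒/-≤ : ∀ a b c d .{{_ : NonZero b}} .{{_ : NonZero d}} → a * d ≤ c * b → + a / b ℚ.≤ + c / d
cross-≤⇒/-≤ a b@(suc _) c d@(suc _) ad≤cb = ℚₚ.toℚᵘ-cancel-≤ (begin
  toℚᵘ (+ a / b)  ≃⟨ toℚᵘ-/ a b ⟩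
  + a ℚᵘ./ b      ≤⟨ ℚᵘ.*≤* (subst₂ ℤ._≤_ (ℤₚ.pos-* a d) (ℤₚ.pos-* c b) (+≤+ ad≤cb)) ⟩
  + c ℚᵘ./ d      ≃⟨ toℚᵘ-/ c d ⟨
  toℚᵘ (+ c / d)  ∎)
  where open ℚᵘₚ.≤-Reasoning

cross-<⇒/-< : ∀ a b c d .{{_ : NonZero b}} .{{_ : NonZero d}} → a * d < c * b → + a / b ℚ.< + c / d
cross-<⇒/-< a b@(suc _) c d@(suc _) ad<cb = ℚₚ.toℚᵘ-cancel-< (begin-strict
  toℚᵘ (+ a / b)  ≃⟨ toℚᵘ-/ a b ⟩
  + a ℚᵘ./ b      <⟨ ℚᵘ.*<* (subst₂ ℤ._<_ (ℤₚ.pos-* a d) (ℤₚ.pos-* c b) (+<+ ad<cb)) ⟩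
  + c ℚᵘ./ d      ≃⟨ toℚᵘ-/ c d ⟨
  toℚᵘ (+ c / d)  ∎)
  where open ℚᵘₚ.≤-Reasoning

cross-≡⇒/-≡ : ∀ a b c d .{{_ : NonZero b}} .{{_ : NonZero d}} → a * d ≡ c * b → + a / b ≡ + c / d
cross-≡⇒/-≡ a b c d ad≡cb =
  ℚₚ.≤-antisym (cross-≤⇒/-≤ a b c d (≤-reflexive ad≡cb)) (cross-≤⇒/-≤ c d a b (≤-reflexive (sym ad≡cb)))

/-+-/ : ∀ a b c d .{{_ : NonZero b}} .{{_ : NonZero d}} →
        + a / b ℚ.+ + c / d ≡ _/_ (+ (a * d + c * b)) (b * d) {{m*n≢0 b d}}
/-+-/ a b@(suc _) c d@(suc _) = ℚₚ.toℚᵘ-injective (begin-equality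
  toℚᵘ (+ a / b ℚ.+ + c / d)          ≃⟨ ℚₚ.toℚᵘ-homo-+ (+ a / b) (+ c / d) ⟩
  toℚᵘ (+ a / b) ℚᵘ.+ toℚᵘ (+ c / d)  ≃⟨ ℚᵘₚ.+-cong (toℚᵘ-/ a b) (toℚᵘ-/ c d) ⟩
  + a ℚᵘ./ b ℚᵘ.+ + c ℚᵘ./ d          ≡⟨ cong (ℚᵘ._/ (b * d)) numerator ⟩
  + (a * d + c * b) ℚᵘ./ (b * d)      ≃⟨ toℚᵘ-/ (a * d + c * b) (b * d) ⟨
  toℚᵘ (+ (a * d + c * b) / (b * d))  ∎)
  where
  open ℚᵘₚ.≤-Reasoning
  numerator : + a ℤ.* + d ℤ.+ + c ℤ.* + b ≡ + (a * d + c * b)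
  numerator = sym (trans (ℤₚ.pos-+ (a * d) (c * b)) (cong₂ ℤ._+_ (ℤₚ.pos-* a d) (ℤₚ.pos-* c b)))

x-y≤δ : ∀ {x y c δ} → x ℚ.≤ c → c ℚ.≤ y ℚ.+ δ → x ℚ.- y ℚ.≤ δ
x-y≤δ {x} {y} {c} {δ} x≤c c≤y+δ = begin
  x ℚ.- y          ≤⟨ ℚₚ.+-monoˡ-≤ (- y) (ℚₚ.≤-trans x≤c c≤y+δ) ⟩
  y ℚ.+ δ ℚ.- y    ≡⟨ xyx⁻¹≈y y δ ⟩
  δ                ∎
  where open ℚₚ.≤-Reasoning

∣x-y∣≤δ : ∀ {x y c δ} → x ℚ.≤ c × c ℚ.≤ x ℚ.+ δ → y ℚ.≤ c × c ℚ.≤ y ℚ.+ δ → ∣ x ℚ.- y ∣ ℚ.≤ δ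
∣x-y∣≤δ {x} {y} (x≤c , c≤x+δ) (y≤c , c≤y+δ) with ℚₚ.∣p∣≡p∨∣p∣≡-p (x ℚ.- y)
... | inj₁ ∣x-y∣≡x-y    = subst (ℚ._≤ _) (sym ∣x-y∣≡x-y) (x-y≤δ x≤c c≤y+δ)
... | inj₂ ∣x-y∣≡-[x-y] =
  subst (ℚ._≤ _) (sym (trans ∣x-y∣≡-[x-y] (⁻¹-anti-homo‿- x y))) (x-y≤δ y≤c c≤x+δ)

converges-if-sandwiched : ∀ (a c δ : ℕ → ℚ) (N : ℕ → ℕ) →
                          (∀ L n → N L ≤ n → a n ℚ.≤ c L × c L ℚ.≤ a n ℚ.+ δ L) →
                          (∀ ε → 0ℚ ℚ.< ε → ∃[ L ] δ L ℚ.< ε) →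
                          Converges a
converges-if-sandwiched a c δ N sandwich δ-small ε 0<ε with δ-small ε 0<ε
... | L , δ<ε = N L , λ m n N≤m N≤n →
  ℚₚ.≤-<-trans (∣x-y∣≤δ (sandwich L m N≤m) (sandwich L n N≤n)) δ<ε

converges-if-eventually-constant : ∀ (a : ℕ → ℚ) c N → (∀ n → N ≤ n → a n ≡ c) → Converges a
converges-if-eventually-constant a c N a≡c ε 0<ε = N , λ m n N≤m N≤n →
  subst (ℚ._< ε) (sym (trans (cong₂ (λ x y → ∣ x ℚ.- y ∣) (a≡c m N≤m) (a≡c n N≤n))
                             (cong ∣_∣ (ℚₚ.+-inverseʳ c))))
        0<ε

n<k^n : ∀ {k} → 2 ≤ k → ∀ n → n < k ^ n
n<k^n     2≤k zero    = z<s
n<k^n {k} 2≤k (suc n) = begin-strict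
  suc n          <⟨ s≤s (n<k^n 2≤k n) ⟩
  1 + k ^ n      ≤⟨ +-monoˡ-≤ (k ^ n) (≤-trans (s≤s z≤n) (n<k^n 2≤k n)) ⟩
  k ^ n + k ^ n  ≡⟨ cong (λ m → k ^ n + m) (+-identityʳ (k ^ n)) ⟨
  2 * k ^ n      ≤⟨ *-monoˡ-≤ (k ^ n) 2≤k ⟩
  k ^ suc n      ∎
  where open ≤-Reasoning

^-double : ∀ k n → k ^ (2 * n) ≡ k ^ n * k ^ n
^-double k n = trans (cong (λ m → k ^ (n + m)) (+-identityʳ n)) (^-distribˡ-+-* k n n)

framed-length : ∀ L {n} → L + L ≤ n → n ≡ L + ((n ∸ (L + L)) + L)
framed-length L {n} 2L≤n = trans (sym (m∸n+n≡m 2L≤n)) (rearrange (n ∸ (L + L)) L)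
  where
  rearrange : ∀ t L → t + (L + L) ≡ L + (t + L)
  rearrange = solve-∀

module Density (k : ℕ) .{{_ : NonZero k}} where

  _/k^_ : ℕ → ℕ → ℚ
  a /k^ e = _/_ (+ a) (k ^ e) {{m^n≢0 k e}}

  ∃c/k^L<ε : 2 ≤ k → ∀ c ε → 0ℚ ℚ.< ε → ∃[ L ] c /k^ L ℚ.< ε
  ∃c/k^L<ε 2≤k c ε@(mkℚ +[1+ p ] q _) _ = L , subst (c /k^ L ℚ.<_) (ℚₚ.↥p/↧p≡p ε)
    (cross-<⇒/-< c (k ^ L) (suc p) (suc q) {{m^n≢0 k L}} (begin-strict
      c * suc q      <⟨ n<k^n 2≤k L ⟩
      k ^ L          ≤⟨ m≤n*m (k ^ L) (suc p) ⟩
      suc p * k ^ L  ∎))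
    where
    open ≤-Reasoning
    L : ℕ
    L = c * suc q
  ∃c/k^L<ε 2≤k c (mkℚ +0 _ _)       (ℚ.*<* (+<+ ()))
  ∃c/k^L<ε 2≤k c (mkℚ -[1+ _ ] _ _) (ℚ.*<* ())

  density : ℕ → ℕ → ℚ
  density L n = #noBorderBelow k L n /k^ (2 * n)

  ratio≡density : ∀ n → ratio k n ≡ density n n
  ratio≡density n = cong (_/k^ (2 * n)) (U≡#noBorderBelow k n)

  density-antitone : ∀ n {L M} → L ≤ M → density M n ℚ.≤ density L n
  density-antitone n {L} {M} L≤M =
    cross-≤⇒/-≤ (#noBorderBelow k M n) (k ^ (2 * n)) (#noBorderBelow k L n) (k ^ (2 * n))
                {{m^n≢0 k (2 * n)}} {{m^n≢0 k (2 * n)}}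
                (*-monoˡ-≤ (k ^ (2 * n)) (#noBorderBelow-antitone k n L≤M))

  density-framed : ∀ L t → density L (L + (t + L)) ≡ density L (L + L)
  density-framed L t =
    cross-≡⇒/-≡ (#noBorderBelow k L (L + (t + L))) (k ^ (2 * (L + (t + L)))) N K
                {{m^n≢0 k (2 * (L + (t + L)))}} {{m^n≢0 k (2 * (L + L))}} (begin
      #noBorderBelow k L (L + (t + L)) * K  ≡⟨ cong (_* K) (#noBorderBelow-framed k L t) ⟩
      y * (y * N) * K                       ≡⟨ rearrange y N K ⟩
      N * (y * (y * K))                     ≡⟨ cong (N *_) k^2n≡yyK ⟨
      N * k ^ (2 * (L + (t + L)))           ∎)
    where
    open ≡-Reasoning
    y N K : ℕ
    y = k ^ t
    N = #noBorderBelow k L (L + L)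
    K = k ^ (2 * (L + L))
    rearrange : ∀ a b c → a * (a * b) * c ≡ b * (a * (a * c))
    rearrange = solve-∀
    exponent : ∀ L t → 2 * (L + (t + L)) ≡ t + (t + 2 * (L + L))
    exponent = solve-∀
    k^2n≡yyK : k ^ (2 * (L + (t + L))) ≡ y * (y * K)
    k^2n≡yyK = trans (cong (k ^_) (exponent L t))
                     (trans (^-distribˡ-+-* k t _) (cong (y *_) (^-distribˡ-+-* k t _)))

  density≤ratio+4/kᴸ : 2 ≤ k → ∀ {L n} → L ≤ n → density L n ℚ.≤ ratio k n ℚ.+ 4 /k^ L
  density≤ratio+4/kᴸ 2≤k {L} {n} L≤n =
    subst (density L n ℚ.≤_) (sym (/-+-/ Uₙ D 4 x {{m^n≢0 k (2 * n)}} {{m^n≢0 k L}}))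
      (cross-≤⇒/-≤ V D (Uₙ * x + 4 * D) (D * x)
                   {{m^n≢0 k (2 * n)}} {{m*n≢0 D x {{m^n≢0 k (2 * n)}} {{m^n≢0 k L}}}} (begin
        V * (D * x)                                 ≤⟨ *-monoˡ-≤ (D * x)
                                                         (#noBorderBelow≤U+4kⁿkʲ 2≤k L (n ∸ L) n≡L+[n∸L]) ⟩
        (Uₙ + k ^ n * (2 * (2 * z))) * (D * x)      ≡⟨ cong₂ (λ a b → (Uₙ + a * (2 * (2 * z))) * (b * x))
                                                             kⁿ≡xz D≡xzxz ⟩
        (Uₙ + x * z * (2 * (2 * z)))
          * (x * z * (x * z) * x)                   ≡⟨ rearrange Uₙ x z ⟩
        (Uₙ * x + 4 * (x * z * (x * z)))
          * (x * z * (x * z))                       ≡⟨ cong (λ b → (Uₙ * x + 4 * b) * b) D≡xzxz ⟨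
        (Uₙ * x + 4 * D) * D                        ∎))
    where
    open ≤-Reasoning
    Uₙ V D x z : ℕ
    Uₙ = U k n
    V = #noBorderBelow k L n
    D = k ^ (2 * n)
    x = k ^ L
    z = k ^ (n ∸ L)
    n≡L+[n∸L] : n ≡ L + (n ∸ L)
    n≡L+[n∸L] = sym (m+[n∸m]≡n L≤n)
    kⁿ≡xz : k ^ n ≡ x * z
    kⁿ≡xz = trans (cong (k ^_) n≡L+[n∸L]) (^-distribˡ-+-* k L (n ∸ L))
    D≡xzxz : D ≡ x * z * (x * z)
    D≡xzxz = trans (^-double k n) (cong₂ _*_ kⁿ≡xz kⁿ≡xz)
    rearrange : ∀ a b c → (a + b * c * (2 * (2 * c))) * (b * c * (b * c) * b)
                          ≡ (a * b + 4 * (b * c * (b * c))) * (b * c * (b * c))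
    rearrange = solve-∀

  ratio-sandwich : 2 ≤ k → ∀ L n → L + L ≤ n →
                   ratio k n ℚ.≤ density L (L + L) × density L (L + L) ℚ.≤ ratio k n ℚ.+ 4 /k^ L
  ratio-sandwich 2≤k L n 2L≤n =
    ratio≤ , subst (ℚ._≤ ratio k n ℚ.+ 4 /k^ L) densityₙ≡density₂ₗ
                   (density≤ratio+4/kᴸ 2≤k L≤n)
    where
    L≤n : L ≤ n
    L≤n = ≤-trans (m≤m+n L L) 2L≤n
    densityₙ≡density₂ₗ : density L n ≡ density L (L + L)
    densityₙ≡density₂ₗ = trans (cong (density L) (framed-length L 2L≤n)) (density-framed L _)
    ratio≤ : ratio k n ℚ.≤ density L (L + L)
    ratio≤ = begin
      ratio k n          ≡⟨ ratio≡density n ⟩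
      density n n        ≤⟨ density-antitone n L≤n ⟩
      density L n        ≡⟨ densityₙ≡density₂ₗ ⟩
      density L (L + L)  ∎
      where open ℚₚ.≤-Reasoning

-- The step through #noBorderBelow-framed framed-ends in evaluation: the only pair of unary words of
-- length 4 has a border of length 1, so #noBorderBelow 1 2 4 computes to 0.
U-unary≡0 : ∀ n → 4 ≤ n → U 1 n ≡ 0
U-unary≡0 n 4≤n = n≤0⇒n≡0 (begin
  U 1 n                             ≡⟨ U≡#noBorderBelow 1 n ⟩
  #noBorderBelow 1 n n              ≤⟨ #noBorderBelow-antitone 1 n (≤-trans (s≤s (s≤s z≤n)) 4≤n) ⟩
  #noBorderBelow 1 2 n              ≡⟨ cong (#noBorderBelow 1 2) (framed-length 2 4≤n) ⟩
  #noBorderBelow 1 2 (2 + (t + 2))  ≡⟨ #noBorderBelow-framed 1 2 t ⟩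
  1 ^ t * (1 ^ t * 0)               ≡⟨ trans (cong (1 ^ t *_) (*-zeroʳ (1 ^ t))) (*-zeroʳ (1 ^ t)) ⟩
  0                                 ∎)
  where
  open ≤-Reasoning
  t : ℕ
  t = n ∸ 4

corollary12 : (k : ℕ) .{{_ : NonZero k}} → Converges (ratio k)
corollary12 1 = converges-if-eventually-constant (ratio 1) 0ℚ 4 λ n 4≤n →
  trans (cong (_/k^ (2 * n)) (U-unary≡0 n 4≤n)) (ℚₚ.0/n≡0 (1 ^ (2 * n)) {{m^n≢0 1 (2 * n)}})
  where open Density 1
corollary12 k@(suc (suc _)) =
  converges-if-sandwiched (ratio k) (λ L → density L (L + L)) (4 /k^_) (λ L → L + L)
                          (ratio-sandwich 2≤k) (∃c/k^L<ε 2≤k 4)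
  where
  open Density k
  2≤k : 2 ≤ k
  2≤k = s≤s (s≤s z≤n)
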